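{- Let $A$ be a totally ordered alphabet and $w$ a nonempty finite word over $A$. Then $w$ is a Lyndon word if and only if $u^\omega<v^\omega$ for every factorization $w=uv$ with $u,v$ nonempty; and $w$ is a Lyndon word if and only if $w^\omega<v^\omega$ for every factorization $w=uv$ with $u,v$ nonempty.
   Context: The order $<$ on finite and infinite words is the lexicographical order induced by the order of $A$. For a nonempty finite word $x$, $x^\omega=xxx\cdots$. A nonempty word $w$ is a Lyndon word if for every factorization $w=uv$ with $u,v$ nonempty one has $w<v$. -}

module Defs where

open import Data.Nat using (ℕ; _<_; _%_)
open import Data.Nat.DivMod using (m%n<n)
open import Data.List using (List; _++_; length; lookup)
open import Data.List.NonEmpty using (List⁺; toList; length)
open import Data.Fin using (fromℕ<)
open import Data.Product using (Σ; _×_; ∃)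
open import Relation.Binary.PropositionalEquality using (_≡_)
open import Data.List.Relation.Binary.Lex.Strict using (Lex-<)

module Words {A : Set} (_≺_ : A → A → Set) where

  -- lexicographic order on finite words (a proper prefix is smaller)
  _<ʷ_ : List A → List A → Set
  _<ʷ_ = Lex-< _≡_ _≺_

  InfWord : Set
  InfWord = ℕ → A

  _<∞_ : InfWord → InfWord → Set
  x <∞ y = ∃ λ n → (∀ i → i < n → x i ≡ y i) × (x n ≺ y n)

  _^ω : List⁺ A → InfWord
  (x ^ω) i = lookup (toList x) (fromℕ< (m%n<n i (Data.List.NonEmpty.length x)))

  IsLyndon : List⁺ A → Set
  IsLyndon w = ∀ (u v : List⁺ A) → toList w ≡ toList u ++ toList v → toList w <ʷ toList v

-- Everything rests on one fact: for a nonempty word x and an infinite word s,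
-- x^ω < s iff xs < s. Indeed x^ω is the fixed point of s ↦ xs, and comparing
-- either side with s either decides within the first copy of x or reduces to
-- the same comparison with s replaced by a suffix s' where s = xs'.
-- For a factorization w = uv this turns both u^ω < v^ω and w^ω < v^ω into
-- wv^ω < v^ω. If w is Lyndon, then w < v and v is not a prefix of w, so
-- wv^ω < vv^ω = v^ω. Conversely, if w is not Lyndon then v ≤ w: either v is
-- a prefix of w = vt, and cancelling v in vtv^ω < vv^ω gives t^ω < v^ω against
-- the hypothesis for w = vt, or v^ω = vv^ω < wv^ω, contradicting wv^ω < v^ω.
module Submission where

open import Defs
open import Data.Product using (_×_)
open import Data.List using (_++_)
open import Data.List.NonEmpty using (List⁺; toList)
open import Function.Bundles using (_⇔_)
open import Relation.Binary.PropositionalEquality using (_≡_)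
open import Relation.Binary.Structures using (IsStrictTotalOrder)

open import Data.Empty using (⊥-elim)
open import Data.Fin using (fromℕ<)
open import Data.Fin.Properties using (fromℕ<-cong)
open import Data.List using (List; []; _∷_; length; lookup)
open import Data.List.NonEmpty using (_∷_)
open import Data.List.Properties using (length-++-≤ˡ; length-++-≤ʳ)
open import Data.List.Relation.Binary.Lex.Core using (halt; this; next)
open import Data.List.Relation.Binary.Lex.Strict using (<-compare)
open import Data.List.Relation.Binary.Pointwise using (Pointwise-≡⇒≡)
open import Data.Nat using (ℕ; zero; suc; _+_; _≤_; _<_; _%_; s≤s; z≤n)
open import Data.Nat.DivMod using (m<n⇒m%n≡m; [m+n]%n≡m%n)
open import Data.Nat.Induction using (<-rec)
open import Data.Nat.Properties using (<-cmp; <⇒≢; ≤-trans; ≤-reflexive; m≤n+m; +-comm)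
open import Data.Product using (∃; _,_)
open import Data.Sum using (_⊎_; inj₁; inj₂)
open import Function.Bundles using (mk⇔; Equivalence)
open import Function.Construct.Composition using (_⇔-∘_)
open import Induction.WellFounded using (WfRec)
open import Relation.Binary.Definitions using (tri<; tri≈; tri>)
open import Relation.Binary.PropositionalEquality
  using (_≢_; _≗_; refl; sym; trans; cong; subst)
open import Relation.Binary.Structures using (IsStrictPartialOrder)
open import Relation.Nullary using (¬_)

module InfiniteWords {A : Set} (_≺_ : A → A → Set) where
  open Words _≺_

  _<[_]_ : InfWord → ℕ → InfWord → Set
  x <[ n ] y = (∀ i → i < n → x i ≡ y i) × (x n ≺ y n)

  tail : InfWord → InfWord
  tail x i = x (suc i)

  infixr 25 _++∞_
  _++∞_ : List A → InfWord → InfWord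
  [] ++∞ s = s
  ((a ∷ p) ++∞ s) zero = a
  ((a ∷ p) ++∞ s) (suc i) = (p ++∞ s) i

  ≗-refl : {x : InfWord} → x ≗ x
  ≗-refl _ = refl

  ≗-sym : {x y : InfWord} → x ≗ y → y ≗ x
  ≗-sym x≗y i = sym (x≗y i)

  head∧tail⇒≗ : {x y : InfWord} → x zero ≡ y zero → tail x ≗ tail y → x ≗ y
  head∧tail⇒≗ h t zero = h
  head∧tail⇒≗ h t (suc i) = t i

  ++∞-congʳ : ∀ p {s t} → s ≗ t → p ++∞ s ≗ p ++∞ t
  ++∞-congʳ [] s≗t = s≗t
  ++∞-congʳ (a ∷ p) s≗t = head∧tail⇒≗ refl (++∞-congʳ p s≗t)

  ++∞-assoc : ∀ p q s → (p ++ q) ++∞ s ≗ p ++∞ q ++∞ s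
  ++∞-assoc [] q s i = refl
  ++∞-assoc (a ∷ p) q s = head∧tail⇒≗ refl (++∞-assoc p q s)

  ≡++⇒++∞≗ : ∀ {w} p q s → w ≡ p ++ q → w ++∞ s ≗ p ++∞ q ++∞ s
  ≡++⇒++∞≗ p q s refl = ++∞-assoc p q s

  ≗-++∞ : ∀ l s (t : InfWord) →
          (∀ i (i<l : i < length l) → t i ≡ lookup l (fromℕ< i<l)) →
          (∀ j → t (length l + j) ≡ s j) → t ≗ l ++∞ s
  ≗-++∞ [] s t _ shift = shift
  ≗-++∞ (a ∷ l) s t prefix shift =
    head∧tail⇒≗ (prefix zero (s≤s z≤n))
      (≗-++∞ l s (tail t) (λ i i<l → prefix (suc i) (s≤s i<l)) shift)

  ^ω-unfold : ∀ x → (x ^ω) ≗ toList x ++∞ (x ^ω)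
  ^ω-unfold x@(a ∷ as) = ≗-++∞ (toList x) (x ^ω) (x ^ω)
    (λ i i<l → cong (lookup (toList x)) (fromℕ<-cong _ _ (m<n⇒m%n≡m i<l) _ _))
    (λ j → cong (lookup (toList x)) (fromℕ<-cong _ _ (period j) _ _))
    where
    period : ∀ j → (suc (length as) + j) % suc (length as) ≡ j % suc (length as)
    period j = trans (cong (_% suc (length as)) (+-comm (suc (length as)) j))
                     ([m+n]%n≡m%n j (suc (length as)))

  <[]-resp-≗ : ∀ {x x′ y y′ n} → x ≗ x′ → y ≗ y′ → x <[ n ] y → x′ <[ n ] y′
  <[]-resp-≗ {n = n} x≗x′ y≗y′ (agree , x≺y) =
    (λ i i<n → trans (sym (x≗x′ i)) (trans (agree i i<n) (y≗y′ i))) ,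
    subst (_≺ _) (x≗x′ n) (subst (_ ≺_) (y≗y′ n) x≺y)

  <∞-resp-≗ : ∀ {x x′ y y′} → x ≗ x′ → y ≗ y′ → x <∞ y → x′ <∞ y′
  <∞-resp-≗ x≗x′ y≗y′ (n , x<y) = n , <[]-resp-≗ x≗x′ y≗y′ x<y

  tail-<[] : ∀ {x y n} → x <[ suc n ] y → tail x <[ n ] tail y
  tail-<[] (agree , x≺y) = (λ i i<n → agree (suc i) (s≤s i<n)) , x≺y

  <[]-suc : ∀ {x y n} → x zero ≡ y zero → tail x <[ n ] tail y → x <[ suc n ] y
  <[]-suc head (agree , x≺y) = (λ { zero _ → head ; (suc i) (s≤s i<n) → agree i i<n }) , x≺y

  <∞-suc : ∀ {x y} → x zero ≡ y zero → tail x <∞ tail y → x <∞ y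
  <∞-suc head (n , x<y) = suc n , <[]-suc head x<y

  ++∞-mono-<∞ : ∀ p {s t} → s <∞ t → p ++∞ s <∞ p ++∞ t
  ++∞-mono-<∞ [] s<t = s<t
  ++∞-mono-<∞ (a ∷ p) s<t = <∞-suc refl (++∞-mono-<∞ p s<t)

  data Split (p : List A) (s y : InfWord) (n : ℕ) : Set where
    inside : (∀ z → p ++∞ z <∞ y) → Split p s y n
    beyond : ∀ {y′ m} → y ≗ p ++∞ y′ → length p + m ≡ n → s <[ m ] y′ → Split p s y n

  split : ∀ p {s y n} → p ++∞ s <[ n ] y → Split p s y n
  split [] s<y = beyond ≗-refl refl s<y
  split (a ∷ p) {n = zero} (_ , a≺y₀) = inside λ z → zero , (λ _ ()) , a≺y₀
  split (a ∷ p) {n = suc n} s<y@(agree , _) with split p (tail-<[] s<y)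
  ... | inside p<y = inside λ z → <∞-suc (agree zero (s≤s z≤n)) (p<y z)
  ... | beyond y≗ eq s<y′ =
    beyond (head∧tail⇒≗ (sym (agree zero (s≤s z≤n))) y≗) (cong suc eq) s<y′

  module _ (x : List⁺ A) {P : InfWord} (P-fix : P ≗ toList x ++∞ P) where

    private
      beyond-< : ∀ {m n} → length (toList x) + m ≡ n → m < n
      beyond-< {m} refl = s≤s (m≤n+m m _)

    ++∞<⇒fix< : ∀ {s} → toList x ++∞ s <∞ s → P <∞ s
    ++∞<⇒fix< (n , r) = <-rec Goal step n r
      where
      Goal : ℕ → Set
      Goal n = ∀ {s} → toList x ++∞ s <[ n ] s → P <∞ s
      step : ∀ n → WfRec _<_ Goal n → Goal n
      step n rec r with split (toList x) r
      ... | inside x<s = <∞-resp-≗ (≗-sym P-fix) ≗-refl (x<s P)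
      ... | beyond s≗ eq s<s′ =
        <∞-resp-≗ (≗-sym P-fix) (≗-sym s≗)
          (++∞-mono-<∞ (toList x) (rec (beyond-< eq) (<[]-resp-≗ s≗ ≗-refl s<s′)))

    fix<⇒++∞< : ∀ {s} → P <∞ s → toList x ++∞ s <∞ s
    fix<⇒++∞< (n , r) = <-rec Goal step n r
      where
      Goal : ℕ → Set
      Goal n = ∀ {s} → P <[ n ] s → toList x ++∞ s <∞ s
      step : ∀ n → WfRec _<_ Goal n → Goal n
      step n rec r with split (toList x) (<[]-resp-≗ P-fix ≗-refl r)
      ... | inside x<s = x<s _
      ... | beyond s≗ eq P<s′ =
        <∞-resp-≗ (≗-sym (++∞-congʳ (toList x) s≗)) (≗-sym s≗)
          (++∞-mono-<∞ (toList x) (rec (beyond-< eq) P<s′))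

  ^ω<⇔++∞< : ∀ x s → (x ^ω) <∞ s ⇔ toList x ++∞ s <∞ s
  ^ω<⇔++∞< x s = mk⇔ (fix<⇒++∞< x (^ω-unfold x)) (++∞<⇒fix< x (^ω-unfold x))

  factor-^ω<⇔ : ∀ w u v → toList w ≡ toList u ++ toList v →
                (u ^ω) <∞ (v ^ω) ⇔ toList w ++∞ (v ^ω) <∞ (v ^ω)
  factor-^ω<⇔ w u v w≡uv = ⇔-≗ ⇔-∘ ^ω<⇔++∞< u (v ^ω)
    where
    uV≗wV : toList u ++∞ (v ^ω) ≗ toList w ++∞ (v ^ω)
    uV≗wV i = trans (++∞-congʳ (toList u) (^ω-unfold v) i)
                    (sym (≡++⇒++∞≗ (toList u) (toList v) (v ^ω) w≡uv i))
    ⇔-≗ : toList u ++∞ (v ^ω) <∞ (v ^ω) ⇔ toList w ++∞ (v ^ω) <∞ (v ^ω)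
    ⇔-≗ = mk⇔ (<∞-resp-≗ uV≗wV ≗-refl) (<∞-resp-≗ (≗-sym uV≗wV) ≗-refl)

  LyndonByFactorPowers : List⁺ A → Set
  LyndonByFactorPowers w = ∀ u v → toList w ≡ toList u ++ toList v → (u ^ω) <∞ (v ^ω)

  LyndonByPower : List⁺ A → Set
  LyndonByPower w = ∀ u v → toList w ≡ toList u ++ toList v → (w ^ω) <∞ (v ^ω)

  lyndonByFactorPowers⇔lyndonByPower : ∀ w → LyndonByFactorPowers w ⇔ LyndonByPower w
  lyndonByFactorPowers⇔lyndonByPower w = mk⇔
    (λ h u v w≡uv → Equivalence.from (^ω<⇔++∞< w (v ^ω))
                      (Equivalence.to (factor-^ω<⇔ w u v w≡uv) (h u v w≡uv)))
    (λ h u v w≡uv → Equivalence.from (factor-^ω<⇔ w u v w≡uv)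
                      (Equivalence.to (^ω<⇔++∞< w (v ^ω)) (h u v w≡uv)))

  <ʷ⇒prefix⊎<∞ : ∀ {v w} → v <ʷ w →
                 (∃ λ (t : List⁺ A) → w ≡ v ++ toList t) ⊎ (∀ X Y → v ++∞ X <∞ w ++∞ Y)
  <ʷ⇒prefix⊎<∞ {w = b ∷ w} halt = inj₁ (b ∷ w , refl)
  <ʷ⇒prefix⊎<∞ (this a≺b) = inj₂ λ X Y → zero , (λ _ ()) , a≺b
  <ʷ⇒prefix⊎<∞ (next refl v<w) with <ʷ⇒prefix⊎<∞ v<w
  ... | inj₁ (t , w≡vt) = inj₁ (t , cong (_ ∷_) w≡vt)
  ... | inj₂ v<∞w = inj₂ λ X Y → <∞-suc refl (v<∞w X Y)

  ≢-nonempty-++ : ∀ (u : List⁺ A) {xs ys} → length xs ≤ length ys → xs ≢ toList u ++ ys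
  ≢-nonempty-++ (a ∷ us) {ys = ys} xs≤ys xs≡ =
    <⇒≢ (s≤s (≤-trans xs≤ys (length-++-≤ʳ ys {us}))) (cong length xs≡)

module _ {A : Set} {_≺_ : A → A → Set} (spo : IsStrictPartialOrder _≡_ _≺_) where
  open Words _≺_
  open InfiniteWords _≺_
  open IsStrictPartialOrder spo using (irrefl; asym)

  <∞-asym : ∀ {x y} → x <∞ y → ¬ (y <∞ x)
  <∞-asym (n , agree , x≺y) (m , agree′ , y≺x) with <-cmp n m
  ... | tri< n<m _ _ = irrefl refl (subst (_≺ _) (sym (agree′ n n<m)) x≺y)
  ... | tri≈ _ refl _ = asym x≺y y≺x
  ... | tri> _ _ m<n = irrefl refl (subst (_≺ _) (sym (agree m m<n)) y≺x)

  ++∞-cancel-<∞ : ∀ p {s t} → p ++∞ s <∞ p ++∞ t → s <∞ t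
  ++∞-cancel-<∞ [] s<t = s<t
  ++∞-cancel-<∞ (a ∷ p) (zero , _ , a≺a) = ⊥-elim (irrefl refl a≺a)
  ++∞-cancel-<∞ (a ∷ p) (suc n , s<t) = ++∞-cancel-<∞ p (n , tail-<[] s<t)

module _ {A : Set} {_≺_ : A → A → Set} (sto : IsStrictTotalOrder _≡_ _≺_) where
  open Words _≺_
  open InfiniteWords _≺_
  open IsStrictTotalOrder sto using (isStrictPartialOrder; compare)

  lyndon⇒lyndonByFactorPowers : ∀ w → IsLyndon w → LyndonByFactorPowers w
  lyndon⇒lyndonByFactorPowers w lyndon u v w≡uv with <ʷ⇒prefix⊎<∞ (lyndon u v w≡uv)
  ... | inj₁ (t , v≡wt) = ⊥-elim (≢-nonempty-++ u w≤v w≡uv)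
    where
    w≤v : length (toList w) ≤ length (toList v)
    w≤v = subst (λ z → length (toList w) ≤ length z) (sym v≡wt) (length-++-≤ˡ (toList w))
  ... | inj₂ w<∞v = Equivalence.from (factor-^ω<⇔ w u v w≡uv)
    (<∞-resp-≗ ≗-refl (≗-sym (^ω-unfold v)) (w<∞v (v ^ω) (v ^ω)))

  <ʷ⇒¬++∞^ω< : ∀ w v → LyndonByFactorPowers w → toList v <ʷ toList w →
               ¬ (toList w ++∞ (v ^ω) <∞ (v ^ω))
  <ʷ⇒¬++∞^ω< w v powers< v<w wV<V with <ʷ⇒prefix⊎<∞ v<w
  ... | inj₁ (t , w≡vt) =
    <∞-asym isStrictPartialOrder (powers< v t w≡vt)
      (Equivalence.from (^ω<⇔++∞< t (v ^ω))
        (++∞-cancel-<∞ isStrictPartialOrder (toList v)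
          (<∞-resp-≗ (≡++⇒++∞≗ (toList v) (toList t) (v ^ω) w≡vt) (^ω-unfold v) wV<V)))
  ... | inj₂ v<∞w =
    <∞-asym isStrictPartialOrder wV<V
      (<∞-resp-≗ (≗-sym (^ω-unfold v)) ≗-refl (v<∞w (v ^ω) (v ^ω)))

  lyndonByFactorPowers⇒lyndon : ∀ w → LyndonByFactorPowers w → IsLyndon w
  lyndonByFactorPowers⇒lyndon w powers< u v w≡uv
    with <-compare sym compare (toList w) (toList v)
  ... | tri< w<v _ _ = w<v
  ... | tri≈ _ w≈v _ =
    ⊥-elim (≢-nonempty-++ u (≤-reflexive (cong length (Pointwise-≡⇒≡ w≈v))) w≡uv)
  ... | tri> _ _ v<w = ⊥-elim (<ʷ⇒¬++∞^ω< w v powers< v<w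
                                 (Equivalence.to (factor-^ω<⇔ w u v w≡uv) (powers< u v w≡uv)))

  lyndon⇔lyndonByFactorPowers : ∀ w → IsLyndon w ⇔ LyndonByFactorPowers w
  lyndon⇔lyndonByFactorPowers w =
    mk⇔ (lyndon⇒lyndonByFactorPowers w) (lyndonByFactorPowers⇒lyndon w)

corollary4 : {A : Set} (_≺_ : A → A → Set) → IsStrictTotalOrder _≡_ _≺_ →
    (w : List⁺ A) →
    (Words.IsLyndon _≺_ w ⇔ (∀ (u v : List⁺ A) → toList w ≡ toList u ++ toList v → Words._<∞_ _≺_ (Words._^ω _≺_ u) (Words._^ω _≺_ v)))
    × (Words.IsLyndon _≺_ w ⇔ (∀ (u v : List⁺ A) → toList w ≡ toList u ++ toList v → Words._<∞_ _≺_ (Words._^ω _≺_ w) (Words._^ω _≺_ v)))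
corollary4 _≺_ sto w =
  lyndon⇔lyndonByFactorPowers sto w ,
  lyndonByFactorPowers⇔lyndonByPower w ⇔-∘ lyndon⇔lyndonByFactorPowers sto w
  where open InfiniteWords _≺_
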